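{- Let $R$ be a tree with at least two vertices and a distinguished vertex $r$, and let $b>1$ be an integer. Let $T_{1,b}$ be the tree obtained from $R$ by attaching at $r$ a new pendent vertex $u_1$ (adjacent to $r$) and a new path $r v_1v_2\cdots v_b$, vertex-disjoint from it, and let $T_{0,b+1}$ be the tree obtained from $R$ by attaching at $r$ the single new path $r v_1\cdots v_b u_1$ of length $b+1$. Then $TW(T_{1,b})>TW(T_{0,b+1})$.
   Context: A pendent vertex is a vertex of degree $1$; the terminal Wiener index $TW(T)$ of a tree $T$ is the sum of distances over all unordered pairs of distinct pendent vertices of $T$. -}

module Defs where

open import Data.Nat using (ℕ; zero; suc; _+_; _*_; _∸_; _≟_)
open import Data.List using (List; []; _∷_; _++_; map; length; filter)
open import Data.Nat.ListAction using (sum)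
open import Data.Product using (_×_; _,_; proj₁; map₁)
import Relation.Nullary

-- A finite tree with a distinguished vertex (the root), as a rose tree:
-- each vertex is a node with the list of its neighbours away from the root.
data Tree : Set where
  node : List Tree → Tree

-- Vertices are addressed by their position (list of child indices from the root).
-- verts t lists every vertex of t exactly once, paired with its number of children.
mutual
  verts : Tree → List (List ℕ × ℕ)
  verts (node cs) = ([] , length cs) ∷ vertsFrom 0 cs

  vertsFrom : ℕ → List Tree → List (List ℕ × ℕ)
  vertsFrom i [] = []
  vertsFrom i (c ∷ cs) = map (map₁ (i ∷_)) (verts c) ++ vertsFrom (suc i) cs

size : Tree → ℕ
size t = length (verts t)

-- degree in the underlying (unrooted) tree: children, plus the parent if not the root
degree : List ℕ × ℕ → ℕ
degree ([] , k) = k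
degree (_ ∷ _ , k) = suc k

pendents : Tree → List (List ℕ)
pendents t = map proj₁ (filter (λ v → degree v ≟ 1) (verts t))

-- length of the longest common prefix of two positions (depth of their lowest common ancestor)
commonPrefix : List ℕ → List ℕ → ℕ
commonPrefix (a ∷ p) (b ∷ q) with a ≟ b
... | Relation.Nullary.yes _ = suc (commonPrefix p q)
... | Relation.Nullary.no _ = 0
commonPrefix _ _ = 0

-- distance in the tree: the unique path goes up to the lowest common ancestor and down
dist : List ℕ → List ℕ → ℕ
dist p q = (length p + length q) ∸ (2 * commonPrefix p q)

pairSum : List (List ℕ) → ℕ
pairSum [] = 0
pairSum (x ∷ xs) = sum (map (dist x) xs) + pairSum xs

TW : Tree → ℕ
TW t = pairSum (pendents t)

attach : Tree → List Tree → Tree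
attach (node cs) ts = node (cs ++ ts)

-- hangingPath n : a path of n new vertices v₁ … vₙ, with v₁ to be made adjacent to the root
hangingPath : ℕ → List Tree
hangingPath zero = []
hangingPath (suc n) = node (hangingPath n) ∷ []

leaf : Tree
leaf = node []

-- Both trees consist of R together with one extra branch at r, so their pendent
-- vertices are those of R (the root r itself is not pendent) plus the pendent
-- vertices of the new branch: the end u₁ of the path in T_{0,b+1}, and the two
-- ends u₁, v_b in T_{1,b}. Splitting TW into the R–R, R–branch and branch–branch
-- sums, the R–R sums agree; a pendent vertex of R at depth d is at distance
-- d + b + 1 from the end of the long path but d + 1 and d + b from u₁ and v_b;
-- and the branch–branch sum is 0 versus d(u₁, v_b) = b + 1 > 0.
module Submission where

open import Defs
open import Data.Nat using (ℕ; suc; _<_; _≤_; _>_)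
open import Data.List using (_∷_)
open import Data.Nat using (zero; _+_; _≟_; z≤n; s≤s)
open import Data.Nat.Properties
  using (+-identityʳ; +-assoc; +-suc; 1+n≢0; suc-injective; <⇒≢; n<1+n; m<n⇒m<1+n;
         m≤m+n; +-monoˡ-≤; +-monoʳ-≤; +-mono-≤; +-mono-≤-<; ≤-trans; ≤-reflexive;
         module ≤-Reasoning)
open import Data.Nat.Tactic.RingSolver using (solve-∀)
open import Data.Nat.ListAction using (sum)
open import Data.Nat.ListAction.Properties using (sum-++)
open import Data.List using (List; []; _++_; map; length; filter; replicate)
open import Data.List.Properties
  using (map-++; map-∘; ++-identityʳ; ++-assoc; filter-++; filter-reject; length-++-sucʳ)
open import Data.List.Relation.Unary.All as All using (All; []; _∷_; universal)
open import Data.List.Relation.Unary.All.Properties using (++⁺; map⁺; filter⁺)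
open import Data.Product using (_×_; _,_; proj₁; proj₂; map₁)
open import Data.Empty using (⊥; ⊥-elim)
open import Function using (_∘_)
open import Relation.Nullary using (¬_; Dec; yes; no)
open import Relation.Binary.PropositionalEquality
  using (_≡_; refl; sym; trans; cong; cong₂; subst; module ≡-Reasoning)

pendent? : (v : List ℕ × ℕ) → Dec (degree v ≡ 1)
pendent? v = degree v ≟ 1

childless? : (v : List ℕ × ℕ) → Dec (proj₂ v ≡ 0)
childless? v = proj₂ v ≟ 0

pendentsFrom : ℕ → List Tree → List (List ℕ)
pendentsFrom i cs = map proj₁ (filter pendent? (vertsFrom i cs))

leafPositions : Tree → List (List ℕ)
leafPositions t = map proj₁ (filter childless? (verts t))

vertsFrom-++ : ∀ i cs ts → vertsFrom i (cs ++ ts) ≡ vertsFrom i cs ++ vertsFrom (i + length cs) ts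
vertsFrom-++ i [] ts = cong (λ k → vertsFrom k ts) (sym (+-identityʳ i))
vertsFrom-++ i (c ∷ cs) ts = begin
    here ++ vertsFrom (suc i) (cs ++ ts)
  ≡⟨ cong (here ++_) (vertsFrom-++ (suc i) cs ts) ⟩
    here ++ (vertsFrom (suc i) cs ++ vertsFrom (suc i + length cs) ts)
  ≡⟨ cong (λ k → here ++ (vertsFrom (suc i) cs ++ vertsFrom k ts)) (sym (+-suc i (length cs))) ⟩
    here ++ (vertsFrom (suc i) cs ++ vertsFrom (i + length (c ∷ cs)) ts)
  ≡⟨ sym (++-assoc here _ _) ⟩
    vertsFrom i (c ∷ cs) ++ vertsFrom (i + length (c ∷ cs)) ts
  ∎
  where
  open ≡-Reasoning
  here : List (List ℕ × ℕ)
  here = map (map₁ (i ∷_)) (verts c)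

vertsFrom-[_] : ∀ t k → vertsFrom k (t ∷ []) ≡ map (map₁ (k ∷_)) (verts t)
vertsFrom-[ t ] k = ++-identityʳ _

map-proj₁-map₁ : ∀ (f : List ℕ → List ℕ) (xs : List (List ℕ × ℕ)) →
  map proj₁ (map (map₁ f) xs) ≡ map f (map proj₁ xs)
map-proj₁-map₁ f xs = trans (sym (map-∘ xs)) (map-∘ xs)

filter-childless?-map₁ : ∀ (f : List ℕ → List ℕ) xs →
  filter childless? (map (map₁ f) xs) ≡ map (map₁ f) (filter childless? xs)
filter-childless?-map₁ f [] = refl
filter-childless?-map₁ f ((p , zero) ∷ xs) = cong ((f p , 0) ∷_) (filter-childless?-map₁ f xs)
filter-childless?-map₁ f ((p , suc d) ∷ xs) = filter-childless?-map₁ f xs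

-- Below the root a vertex is pendent iff it has no children.
filter-pendent?-map₁-∷ : ∀ k xs →
  filter pendent? (map (map₁ (k ∷_)) xs) ≡ map (map₁ (k ∷_)) (filter childless? xs)
filter-pendent?-map₁-∷ k [] = refl
filter-pendent?-map₁-∷ k ((p , zero) ∷ xs) = cong ((k ∷ p , 0) ∷_) (filter-pendent?-map₁-∷ k xs)
filter-pendent?-map₁-∷ k ((p , suc d) ∷ xs) = filter-pendent?-map₁-∷ k xs

pendentsFrom-[_] : ∀ t k → pendentsFrom k (t ∷ []) ≡ map (k ∷_) (leafPositions t)
pendentsFrom-[ t ] k = begin
    map proj₁ (filter pendent? (vertsFrom k (t ∷ [])))
  ≡⟨ cong (map proj₁ ∘ filter pendent?) (vertsFrom-[ t ] k) ⟩
    map proj₁ (filter pendent? (map (map₁ (k ∷_)) (verts t)))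
  ≡⟨ cong (map proj₁) (filter-pendent?-map₁-∷ k (verts t)) ⟩
    map proj₁ (map (map₁ (k ∷_)) (filter childless? (verts t)))
  ≡⟨ map-proj₁-map₁ (k ∷_) _ ⟩
    map (k ∷_) (leafPositions t)
  ∎
  where open ≡-Reasoning

leafPositions-hangingPath : ∀ n → leafPositions (node (hangingPath n)) ≡ replicate n 0 ∷ []
leafPositions-hangingPath zero = refl
leafPositions-hangingPath (suc n) = begin
    map proj₁ (filter childless? (vertsFrom 0 (t ∷ [])))
  ≡⟨ cong (map proj₁ ∘ filter childless?) (vertsFrom-[ t ] 0) ⟩
    map proj₁ (filter childless? (map (map₁ (0 ∷_)) (verts t)))
  ≡⟨ cong (map proj₁) (filter-childless?-map₁ (0 ∷_) (verts t)) ⟩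
    map proj₁ (map (map₁ (0 ∷_)) (filter childless? (verts t)))
  ≡⟨ map-proj₁-map₁ (0 ∷_) _ ⟩
    map (0 ∷_) (leafPositions t)
  ≡⟨ cong (map (0 ∷_)) (leafPositions-hangingPath n) ⟩
    replicate (suc n) 0 ∷ []
  ∎
  where
  open ≡-Reasoning
  t : Tree
  t = node (hangingPath n)

pendentsFrom-hangingPath : ∀ k n → pendentsFrom k (hangingPath (suc n)) ≡ (k ∷ replicate n 0) ∷ []
pendentsFrom-hangingPath k n =
  trans (pendentsFrom-[ node (hangingPath n) ] k) (cong (map (k ∷_)) (leafPositions-hangingPath n))

pendents-attach : ∀ c cs t ts → pendents (attach (node (c ∷ cs)) (t ∷ ts)) ≡
  pendentsFrom 0 (c ∷ cs) ++ pendentsFrom (length (c ∷ cs)) (t ∷ ts)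
pendents-attach c cs t ts = begin
    map proj₁ (filter pendent? (root ∷ vertsFrom 0 (cs′ ++ ts′)))
  ≡⟨ cong (map proj₁) (filter-reject pendent? {x = root} root-not-pendent) ⟩
    map proj₁ (filter pendent? (vertsFrom 0 (cs′ ++ ts′)))
  ≡⟨ cong (map proj₁ ∘ filter pendent?) (vertsFrom-++ 0 cs′ ts′) ⟩
    map proj₁ (filter pendent? (vertsFrom 0 cs′ ++ vertsFrom (length cs′) ts′))
  ≡⟨ cong (map proj₁) (filter-++ pendent? (vertsFrom 0 cs′) _) ⟩
    map proj₁ (filter pendent? (vertsFrom 0 cs′) ++ filter pendent? (vertsFrom (length cs′) ts′))
  ≡⟨ map-++ proj₁ (filter pendent? (vertsFrom 0 cs′)) _ ⟩
    pendentsFrom 0 cs′ ++ pendentsFrom (length cs′) ts′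
  ∎
  where
  open ≡-Reasoning
  cs′ ts′ : List Tree
  cs′ = c ∷ cs
  ts′ = t ∷ ts
  root : List ℕ × ℕ
  root = [] , length (cs′ ++ ts′)
  root-not-pendent : ¬ (degree root ≡ 1)
  root-not-pendent e = 1+n≢0 (trans (sym (length-++-sucʳ cs t ts)) (suc-injective e))

HeadBelow : ℕ → List ℕ → Set
HeadBelow n [] = ⊥
HeadBelow n (j ∷ _) = j < n

vertsFrom-HeadBelow : ∀ i cs → All (HeadBelow (i + length cs) ∘ proj₁) (vertsFrom i cs)
vertsFrom-HeadBelow i [] = []
vertsFrom-HeadBelow i (c ∷ cs) = ++⁺ (map⁺ (universal (λ _ → i<i+1+n) (verts c))) rest
  where
  i<i+1+n : i < i + suc (length cs)
  i<i+1+n = subst (i <_) (sym (+-suc i (length cs))) (s≤s (m≤m+n i (length cs)))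
  rest : All (HeadBelow (i + suc (length cs)) ∘ proj₁) (vertsFrom (suc i) cs)
  rest = subst (λ m → All (HeadBelow m ∘ proj₁) (vertsFrom (suc i) cs))
               (sym (+-suc i (length cs))) (vertsFrom-HeadBelow (suc i) cs)

pendentsFrom-HeadBelow : ∀ i cs → All (HeadBelow (i + length cs)) (pendentsFrom i cs)
pendentsFrom-HeadBelow i cs = map⁺ (filter⁺ pendent? (vertsFrom-HeadBelow i cs))

dist-branches : ∀ {j k} p q → ¬ (j ≡ k) → dist (j ∷ p) (k ∷ q) ≡ suc (length p) + suc (length q)
dist-branches {j} {k} p q j≢k with j ≟ k
... | yes j≡k = ⊥-elim (j≢k j≡k)
... | no _ = refl

-- Cutting the last edge of a path hanging at the root and re-attaching it to the
-- root does not bring the end vertex closer to vertices in other branches.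
dist-pathEnd≤ : ∀ {j n k} x p q → ¬ (j ≡ n) → ¬ (j ≡ k) →
  dist (j ∷ p) (n ∷ x ∷ q) ≤ dist (j ∷ p) (n ∷ []) + dist (j ∷ p) (k ∷ q)
dist-pathEnd≤ {j} {n} {k} x p q j≢n j≢k = begin
    dist (j ∷ p) (n ∷ x ∷ q)
  ≡⟨ dist-branches p (x ∷ q) j≢n ⟩
    suc ℓ + suc (suc m)
  ≤⟨ m≤m+n _ (suc ℓ) ⟩
    suc ℓ + suc (suc m) + suc ℓ
  ≡⟨ rearrange ℓ m ⟩
    suc ℓ + 1 + (suc ℓ + suc m)
  ≡⟨ sym (cong₂ _+_ (dist-branches p [] j≢n) (dist-branches p q j≢k)) ⟩
    dist (j ∷ p) (n ∷ []) + dist (j ∷ p) (k ∷ q)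
  ∎
  where
  open ≤-Reasoning
  ℓ m : ℕ
  ℓ = length p
  m = length q
  rearrange : ∀ ℓ m → (1 + ℓ) + (2 + m) + (1 + ℓ) ≡ (1 + ℓ) + 1 + ((1 + ℓ) + (1 + m))
  rearrange = solve-∀

pairSumBetween : List (List ℕ) → List (List ℕ) → ℕ
pairSumBetween xs ys = sum (map (λ x → sum (map (dist x) ys)) xs)

pairSum-++ : ∀ xs ys → pairSum (xs ++ ys) ≡ pairSum xs + pairSumBetween xs ys + pairSum ys
pairSum-++ [] ys = refl
pairSum-++ (x ∷ xs) ys = begin
    sum (map (dist x) (xs ++ ys)) + pairSum (xs ++ ys)
  ≡⟨ cong₂ _+_ (trans (cong sum (map-++ (dist x) xs ys)) (sum-++ (map (dist x) xs) _)) (pairSum-++ xs ys) ⟩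
    (a + b) + (pairSum xs + pairSumBetween xs ys + pairSum ys)
  ≡⟨ interchange a b (pairSum xs) (pairSumBetween xs ys) (pairSum ys) ⟩
    (a + pairSum xs) + (b + pairSumBetween xs ys) + pairSum ys
  ∎
  where
  open ≡-Reasoning
  a b : ℕ
  a = sum (map (dist x) xs)
  b = sum (map (dist x) ys)
  interchange : ∀ a b p c q → (a + b) + (p + c + q) ≡ (a + p) + (b + c) + q
  interchange = solve-∀

pairSum-[_,_] : ∀ x y → pairSum (x ∷ y ∷ []) ≡ dist x y
pairSum-[ x , y ] = trans (+-identityʳ _) (+-identityʳ _)

pairSumBetween-[_]≤[_,_] : ∀ x y z {as} → All (λ a → dist a x ≤ dist a y + dist a z) as →
  pairSumBetween as (x ∷ []) ≤ pairSumBetween as (y ∷ z ∷ [])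
pairSumBetween-[ x ]≤[ y , z ] [] = z≤n
pairSumBetween-[ x ]≤[ y , z ] {a ∷ _} (h ∷ hs) =
  +-mono-≤ (≤-trans (+-monoˡ-≤ 0 h) (≤-reflexive (+-assoc (dist a y) (dist a z) 0)))
           (pairSumBetween-[ x ]≤[ y , z ] hs)

lemma4p3 : (R : Tree) → 2 ≤ size R → (b : ℕ) → 1 < b →
    TW (attach R (leaf ∷ hangingPath b)) > TW (attach R (hangingPath (suc b)))
lemma4p3 (node []) (s≤s ()) b _
lemma4p3 (node (c ∷ cs)) _ zero ()
lemma4p3 (node (c ∷ cs)) _ (suc b′) _ = begin-strict
    TW (attach R (hangingPath (suc (suc b′))))
  ≡⟨ TW-T₀ ⟩
    pairSum (A ++ end ∷ [])
  ≡⟨ pairSum-++ A (end ∷ []) ⟩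
    pairSum A + pairSumBetween A (end ∷ []) + 0
  <⟨ +-mono-≤-< (+-monoʳ-≤ (pairSum A) (pairSumBetween-[ end ]≤[ u₁ , v ] (All.map farther A-heads)))
                u₁-v-apart ⟩
    pairSum A + pairSumBetween A (u₁ ∷ v ∷ []) + pairSum (u₁ ∷ v ∷ [])
  ≡⟨ sym (pairSum-++ A (u₁ ∷ v ∷ [])) ⟩
    pairSum (A ++ u₁ ∷ v ∷ [])
  ≡⟨ sym TW-T₁ ⟩
    TW (attach R (leaf ∷ hangingPath (suc b′)))
  ∎
  where
  open ≤-Reasoning
  R : Tree
  R = node (c ∷ cs)
  n : ℕ
  n = length (c ∷ cs)
  A : List (List ℕ)
  A = pendentsFrom 0 (c ∷ cs)
  end u₁ v : List ℕ
  end = n ∷ replicate (suc b′) 0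
  u₁ = n ∷ []
  v = suc n ∷ replicate b′ 0
  TW-T₀ : TW (attach R (hangingPath (suc (suc b′)))) ≡ pairSum (A ++ end ∷ [])
  TW-T₀ = trans (cong pairSum (pendents-attach c cs (node (hangingPath (suc b′))) []))
                (cong (λ ps → pairSum (A ++ ps)) (pendentsFrom-hangingPath n (suc b′)))
  TW-T₁ : TW (attach R (leaf ∷ hangingPath (suc b′))) ≡ pairSum (A ++ u₁ ∷ v ∷ [])
  TW-T₁ = trans (cong pairSum (pendents-attach c cs leaf (hangingPath (suc b′))))
                (cong (λ ps → pairSum (A ++ u₁ ∷ ps)) (pendentsFrom-hangingPath (suc n) b′))
  u₁-v-apart : 0 < pairSum (u₁ ∷ v ∷ [])
  u₁-v-apart = subst (0 <_) (sym (trans pairSum-[ u₁ , v ] (dist-branches [] (replicate b′ 0) (<⇒≢ (n<1+n n)))))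
                     (s≤s z≤n)
  A-heads : All (HeadBelow n) A
  A-heads = pendentsFrom-HeadBelow 0 (c ∷ cs)
  farther : ∀ {a} → HeadBelow n a → dist a end ≤ dist a u₁ + dist a v
  farther {j ∷ p} j<n = dist-pathEnd≤ 0 p (replicate b′ 0) (<⇒≢ j<n) (<⇒≢ (m<n⇒m<1+n j<n))
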